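{- Let $c\in\mathbb{N}$, let $G$ be a graph, and let $A_1$ and $A_2$ be two distinct maximal $c$-inseparable sets in $G$. Then $A_1\cap A_2$ induces a clique in $G$ and has size at most $c$.
   Context: Graphs are finite, simple, undirected. A separation of $G$ is a pair $(A,B)$ with $A\cup B=V(G)$ and no edge between $A\setminus B$ and $B\setminus A$; it separates vertices $x,y$ if $x\in A\setminus B$, $y\in B\setminus A$. A clique separator is $A\cap B$ for a separation separating two vertices with $G[A\cap B]$ a clique (the empty set counts as a clique); its size is $|A\cap B|$. Two vertices are $c$-inseparable if no clique separator of size at most $c$ in $G$ separates them. A set is $c$-inseparable if any two distinct elements are $c$-inseparable, and maximal $c$-inseparable if no proper superset in $V(G)$ is $c$-inseparable. -}

module Defs where

open import Data.Nat using (ℕ; _≤_)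
open import Data.Fin using (Fin)
open import Data.Fin.Subset using (Subset; _∈_; _∉_; _⊂_; _∩_; ∣_∣)
open import Data.Product using (Σ; _×_; ∃₂)
open import Data.Sum using (_⊎_)
open import Relation.Nullary using (¬_)
open import Relation.Binary.PropositionalEquality using (_≡_; _≢_)
open import Data.Bool using (Bool; true; false)

record Graph (n : ℕ) : Set₁ where
  field
    adj     : Fin n → Fin n → Bool
    irrefl  : ∀ x → adj x x ≡ false
    sym     : ∀ x y → adj x y ≡ adj y x

  Adj : Fin n → Fin n → Set
  Adj x y = adj x y ≡ true

module _ {n : ℕ} (G : Graph n) where
  open Graph G

  IsSeparation : Subset n → Subset n → Set
  IsSeparation A B =
    (∀ v → v ∈ A ⊎ v ∈ B) ×
    (∀ x y → x ∈ A → x ∉ B → y ∈ B → y ∉ A → ¬ Adj x y)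

  Separates : Subset n → Subset n → Fin n → Fin n → Set
  Separates A B x y = x ∈ A × x ∉ B × y ∈ B × y ∉ A

  IsClique : Subset n → Set
  IsClique S = ∀ x y → x ∈ S → y ∈ S → x ≢ y → Adj x y

  CSeparable : ℕ → Fin n → Fin n → Set
  CSeparable c x y = ∃₂ λ A B →
    IsSeparation A B × Separates A B x y × IsClique (A ∩ B) × ∣ A ∩ B ∣ ≤ c

  CInseparable : ℕ → Fin n → Fin n → Set
  CInseparable c x y = ¬ CSeparable c x y

  CInseparableSet : ℕ → Subset n → Set
  CInseparableSet c S = ∀ x y → x ∈ S → y ∈ S → x ≢ y → CInseparable c x y

  MaximalCInseparable : ℕ → Subset n → Set
  MaximalCInseparable c S =
    CInseparableSet c S × (∀ T → S ⊂ T → ¬ CInseparableSet c T)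

module Submission where

-- Idea (as in the paper): if A₁ ∪ A₂ were c-inseparable it would strictly
-- extend A₁ or A₂ (they are distinct), contradicting maximality.  Hence some
-- pair x, y ∈ A₁ ∪ A₂ is split by a clique separation (A , B) of order ≤ c.
-- An inseparable set cannot meet both strict sides of such a separation, so
-- x and y lie in different Aᵢ, and then A₁ ⊆ A and A₂ ⊆ B (or vice versa);
-- thus A₁ ∩ A₂ lies inside the clique separator A ∩ B of size ≤ c.
--
-- Constructively the argument only yields the double negation of "A₁ ∩ A₂
-- is covered by a small clique".  Both conclusions (adjacency of two vertices,
-- a bound on a cardinality) are decidable, hence stable, which finishes the
-- proof.

open import Defs
open import Data.Nat using (ℕ; _≤_)
open import Data.Nat.Properties using (≤-trans; _≤?_)
open import Data.Bool using (true)
import Data.Bool.Properties as Bool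
open import Data.Fin.Subset using (Subset; _∩_; _∪_; ∣_∣; _∈_; _∉_; _⊆_; _⊂_)
open import Data.Fin.Subset.Properties
  using (_∈?_; _⊆?_; ⊆-antisym; p⊆q⇒∣p∣≤∣q∣; p⊆p∪q; q⊆p∪q; x∈p∪q⁻; x∈p∩q⁺; x∈p∩q⁻)
open import Data.Fin.Properties using (¬∀⟶∃¬)
open import Data.Product using (_×_; _,_; proj₁; proj₂; ∃)
open import Data.Sum using (_⊎_; inj₁; inj₂; [_,_])
open import Data.Empty using (⊥; ⊥-elim)
open import Function using (id; _∘_)
open import Relation.Nullary using (¬_; yes; no; contradiction)
open import Relation.Nullary.Negation using (¬¬-map)
open import Relation.Nullary.Decidable using (decidable-stable; _→-dec_)
open import Relation.Binary.PropositionalEquality using (_≢_; refl)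

not-⊆-witness : ∀ {n} {p q : Subset n} → ¬ p ⊆ q → ∃ λ i → i ∈ p × i ∉ q
not-⊆-witness {n} {p} {q} p⊈q
  with ¬∀⟶∃¬ n (λ i → i ∈ p → i ∈ q) (λ i → (i ∈? p) →-dec (i ∈? q))
              (λ p⊆q → p⊈q (λ {i} → p⊆q i))
... | i , i∉ with i ∈? p
...   | yes i∈p = i , i∈p , i∉ ∘ (λ i∈q _ → i∈q)
...   | no  i∉p = ⊥-elim (i∉ (λ i∈p → contradiction i∈p i∉p))

distinct⇒union-strict : ∀ {n} {p q : Subset n} →
  p ≢ q → p ⊂ p ∪ q ⊎ q ⊂ p ∪ q
distinct⇒union-strict {p = p} {q} p≢q with p ⊆? q | q ⊆? p
... | yes p⊆q | yes q⊆p = ⊥-elim (p≢q (⊆-antisym p⊆q q⊆p))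
... | yes _   | no  q⊈p = let i , i∈q , i∉p = not-⊆-witness q⊈p in
                          inj₁ (p⊆p∪q q , i , q⊆p∪q p q i∈q , i∉p)
... | no  p⊈q | _       = let i , i∈p , i∉q = not-⊆-witness p⊈q in
                          inj₂ (q⊆p∪q p q , i , p⊆p∪q q i∈p , i∉q)

module _ {n : ℕ} (G : Graph n) (c : ℕ) where

  SmallCliqueSeparation : Subset n → Subset n → Set
  SmallCliqueSeparation A B =
    IsSeparation G A B × IsClique G (A ∩ B) × ∣ A ∩ B ∣ ≤ c

  SmallCliqueCover : Subset n → Set
  SmallCliqueCover X = ∃ λ S → IsClique G S × ∣ S ∣ ≤ c × X ⊆ S

  covered⇒small-clique : ∀ {X} → SmallCliqueCover X → IsClique G X × ∣ X ∣ ≤ c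
  covered⇒small-clique (S , clique , size , X⊆S) =
    (λ x y x∈X y∈X x≢y → clique x y (X⊆S x∈X) (X⊆S y∈X) x≢y) ,
    ≤-trans (p⊆q⇒∣p∣≤∣q∣ X⊆S) size

  no-split : ∀ {X A B x y} → CInseparableSet G c X →
    SmallCliqueSeparation A B → x ∈ X → y ∈ X → Separates G A B x y → ⊥
  no-split {A = A} {B} {x} {y} ins (sep , clique , size) x∈X y∈X split@(x∈A , _ , _ , y∉A) =
    ins x y x∈X y∈X (λ { refl → y∉A x∈A }) (A , B , sep , split , clique , size)

  stays-left : ∀ {X A B x} → CInseparableSet G c X → SmallCliqueSeparation A B →
    x ∈ X → x ∈ A → x ∉ B → X ⊆ A
  stays-left {A = A} ins ss@(sep , _) x∈X x∈A x∉B {z} z∈X with z ∈? A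
  ... | yes z∈A = z∈A
  ... | no  z∉A = ⊥-elim (no-split ins ss x∈X z∈X (x∈A , x∉B , z∈B , z∉A))
    where z∈B = [ (λ z∈A → contradiction z∈A z∉A) , id ] (proj₁ sep z)

  stays-right : ∀ {X A B y} → CInseparableSet G c X → SmallCliqueSeparation A B →
    y ∈ X → y ∈ B → y ∉ A → X ⊆ B
  stays-right {B = B} ins ss@(sep , _) y∈X y∈B y∉A {z} z∈X with z ∈? B
  ... | yes z∈B = z∈B
  ... | no  z∉B = ⊥-elim (no-split ins ss z∈X y∈X (z∈A , z∉B , y∈B , y∉A))
    where z∈A = [ id , (λ z∈B → contradiction z∈B z∉B) ] (proj₁ sep z)

  separator-covers-intersection : ∀ {X₁ X₂ A B x y} →
    CInseparableSet G c X₁ → CInseparableSet G c X₂ → SmallCliqueSeparation A B →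
    x ∈ X₁ → y ∈ X₂ → Separates G A B x y → X₁ ∩ X₂ ⊆ A ∩ B
  separator-covers-intersection {X₁} {X₂} ins₁ ins₂ ss x∈X₁ y∈X₂ (x∈A , x∉B , y∈B , y∉A) z∈
    with x∈p∩q⁻ X₁ X₂ z∈
  ... | z∈X₁ , z∈X₂ = x∈p∩q⁺ ( stays-left  ins₁ ss x∈X₁ x∈A x∉B z∈X₁
                            , stays-right ins₂ ss y∈X₂ y∈B y∉A z∈X₂)

  separable-union⇒cover : ∀ {X₁ X₂ x y} →
    CInseparableSet G c X₁ → CInseparableSet G c X₂ →
    x ∈ X₁ ∪ X₂ → y ∈ X₁ ∪ X₂ → CSeparable G c x y → SmallCliqueCover (X₁ ∩ X₂)
  separable-union⇒cover {X₁} {X₂} ins₁ ins₂ x∈ y∈ (A , B , sep , split , clique , size)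
    with x∈p∪q⁻ X₁ X₂ x∈ | x∈p∪q⁻ X₁ X₂ y∈
  ... | inj₁ x∈X₁ | inj₁ y∈X₁ = ⊥-elim (no-split ins₁ ss x∈X₁ y∈X₁ split)
    where ss = sep , clique , size
  ... | inj₂ x∈X₂ | inj₂ y∈X₂ = ⊥-elim (no-split ins₂ ss x∈X₂ y∈X₂ split)
    where ss = sep , clique , size
  ... | inj₁ x∈X₁ | inj₂ y∈X₂ = A ∩ B , clique , size ,
    separator-covers-intersection ins₁ ins₂ (sep , clique , size) x∈X₁ y∈X₂ split
  ... | inj₂ x∈X₂ | inj₁ y∈X₁ = A ∩ B , clique , size , λ z∈ →
    let z∈X₁ , z∈X₂ = x∈p∩q⁻ X₁ X₂ z∈ in
    separator-covers-intersection ins₂ ins₁ (sep , clique , size) x∈X₂ y∈X₁ split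
      (x∈p∩q⁺ (z∈X₂ , z∈X₁))

  -- The union of two distinct maximal c-inseparable sets is not c-inseparable,
  -- as it would strictly extend one of them.
  maximal-union-separable : ∀ {A₁ A₂} → A₁ ≢ A₂ →
    MaximalCInseparable G c A₁ → MaximalCInseparable G c A₂ →
    ¬ CInseparableSet G c (A₁ ∪ A₂)
  maximal-union-separable A₁≢A₂ (_ , max₁) (_ , max₂) with distinct⇒union-strict A₁≢A₂
  ... | inj₁ A₁⊂A₁∪A₂ = max₁ _ A₁⊂A₁∪A₂
  ... | inj₂ A₂⊂A₁∪A₂ = max₂ _ A₂⊂A₁∪A₂

  intersection-covered : ∀ {A₁ A₂} → A₁ ≢ A₂ →
    MaximalCInseparable G c A₁ → MaximalCInseparable G c A₂ →
    ¬ ¬ SmallCliqueCover (A₁ ∩ A₂)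
  intersection-covered A₁≢A₂ m₁@(ins₁ , _) m₂@(ins₂ , _) no-cover =
    maximal-union-separable A₁≢A₂ m₁ m₂ λ x y x∈ y∈ _ →
      no-cover ∘ separable-union⇒cover ins₁ ins₂ x∈ y∈

lemma8 : (c n : ℕ) (G : Graph n) (A₁ A₂ : Subset n) →
    A₁ ≢ A₂ →
    MaximalCInseparable G c A₁ →
    MaximalCInseparable G c A₂ →
    IsClique G (A₁ ∩ A₂) × ∣ A₁ ∩ A₂ ∣ ≤ c
lemma8 c n G A₁ A₂ A₁≢A₂ m₁ m₂ = clique , size
  where
  small-clique : ¬ ¬ (IsClique G (A₁ ∩ A₂) × ∣ A₁ ∩ A₂ ∣ ≤ c)
  small-clique = ¬¬-map (covered⇒small-clique G c) (intersection-covered G c A₁≢A₂ m₁ m₂)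

  -- adjacency and the size bound are decidable, hence stable under ¬ ¬
  clique : IsClique G (A₁ ∩ A₂)
  clique x y x∈ y∈ x≢y = decidable-stable (Graph.adj G x y Bool.≟ true)
    (¬¬-map (λ small → proj₁ small x y x∈ y∈ x≢y) small-clique)

  size : ∣ A₁ ∩ A₂ ∣ ≤ c
  size = decidable-stable (∣ A₁ ∩ A₂ ∣ ≤? c) (¬¬-map proj₂ small-clique)
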